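{- Let $U$ be a finite set and let $\mathbb{Y}$ be a coherent preference list on $U$ whose induced choice function $f=f_{\mathbb{Y}}$ is substitutable. If $X$ is a member of $\mathbb{Y}$, then every subset of $X$ is a member of $\mathbb{Y}$.
   Context: A choice function on a finite set $U$ is a map $f$ from subsets of $U$ to subsets of $U$ with $f(A)\subseteq A$ for all $A\subseteq U$; it is substitutable if for all $A\subseteq B\subseteq U$ one has $f(B)\cap A\subseteq f(A)$. A preference list $\mathbb{Y}$ on $U$ is an ordered finite list of subsets of $U$ whose last element is the empty set; $X\succ Y$ means $X$ properly precedes $Y$ in the list. The induced choice function $f_{\mathbb{Y}}$ maps $A\subseteq U$ to the first member of $\mathbb{Y}$ contained in $A$. $\mathbb{Y}$ is coherent if for any two members, $X\succ Y$ implies $X\not\subseteq Y$. -}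

module Defs where

open import Data.Nat using (ℕ; _<_)
open import Data.Fin using (Fin)
open import Data.Fin.Subset using (Subset; _⊆_; ⊥; _∩_)
open import Data.Fin.Subset.Properties using (_⊆?_)
open import Data.List using (List; []; _∷_; _∷ʳ_; length; lookup)
open import Data.Product using (∃-syntax; Σ)
open import Relation.Nullary using (¬_; yes; no)
open import Relation.Binary.PropositionalEquality using (_≡_)

-- The finite set U is modelled as Fin n; subsets of U are Subset n.

ChoiceFunction : ℕ → Set
ChoiceFunction n = Subset n → Subset n

IsChoiceFunction : ∀ {n} → ChoiceFunction n → Set
IsChoiceFunction {n} f = (A : Subset n) → f A ⊆ A

Substitutable : ∀ {n} → ChoiceFunction n → Set
Substitutable {n} f = (A B : Subset n) → A ⊆ B → (f B ∩ A) ⊆ f A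

IsPreferenceList : ∀ {n} → List (Subset n) → Set
IsPreferenceList {n} Y = ∃[ ys ] (Y ≡ ys ∷ʳ ⊥)

-- Induced choice function: first member of the list contained in A.
-- (Fallback ⊥ for the empty list never matters for a preference list,
-- whose last element ⊥ is contained in every A.)
induced : ∀ {n} → List (Subset n) → ChoiceFunction n
induced []      A = ⊥
induced (X ∷ Y) A with X ⊆? A
... | yes _ = X
... | no  _ = induced Y A

Coherent : ∀ {n} → List (Subset n) → Set
Coherent Y = (i j : Fin (length Y)) → Data.Fin._<_ i j → ¬ (lookup Y i ⊆ lookup Y j)

module Submission where

-- Write f for the choice function induced by the list Y.
--   (1) f is a choice function: f(A) ⊆ A.
--   (2) If the empty set occurs in Y (as it does in a preference list), then
--       f(A) is always a member of Y, since the scan stops at ∅ at the latest.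
--   (3) If Y is coherent, every member X of Y is chosen from itself,
--       f(X) = X: a member W ⊆ X preceding X would violate coherence.
--   (4) For any substitutable choice function f with f(X) = X, every
--       Z ⊆ X satisfies f(Z) = Z, because Z = f(X) ∩ Z ⊆ f(Z) ⊆ Z.
-- The theorem follows: for Z ⊆ X ∈ Y, (3) and (4) give Z = f(Z), which is a
-- member of Y by (2).

open import Defs
open import Data.Nat using (ℕ; s≤s; z≤n)
open import Data.Fin using (zero; suc)
open import Data.Fin.Subset using (Subset; _⊆_; ⊥) renaming (_∈_ to _∈ₛ_)
open import Data.Fin.Subset.Properties using (_⊆?_; ⊆-antisym; ⊆-min; ⊆-refl; x∈p∩q⁺)
open import Data.List using (List; []; _∷_)
open import Data.List.Membership.Propositional using (_∈_)
open import Data.List.Membership.Propositional.Properties using (∈-++⁺ʳ)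
open import Data.List.Relation.Unary.Any using (here; there; index)
open import Data.List.Relation.Unary.Any.Properties using (lookup-index)
open import Data.Product using (_,_)
open import Data.Empty using (⊥-elim)
open import Relation.Nullary using (yes; no)
open import Relation.Binary.PropositionalEquality using (_≡_; refl; sym; subst)

induced-isChoice : ∀ {n} (Y : List (Subset n)) → IsChoiceFunction (induced Y)
induced-isChoice []      A = ⊆-min A
induced-isChoice (X ∷ Y) A with X ⊆? A
... | yes X⊆A = X⊆A
... | no  _   = induced-isChoice Y A

induced-∈ : ∀ {n} (Y : List (Subset n)) → ⊥ ∈ Y → (A : Subset n) → induced Y A ∈ Y
induced-∈ (X ∷ Y) ⊥∈ A with X ⊆? A
... | yes _ = here refl
induced-∈ (X ∷ Y) (here refl) A | no ∅⊈A = ⊥-elim (∅⊈A (⊆-min A))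
induced-∈ (X ∷ Y) (there ⊥∈) A | no _   = there (induced-∈ Y ⊥∈ A)

coherent-tail : ∀ {n} (W : Subset n) (Y : List (Subset n)) → Coherent (W ∷ Y) → Coherent Y
coherent-tail W Y coh i j i<j = coh (suc i) (suc j) (s≤s i<j)

-- (3) In a coherent list every member is the set chosen from itself: the
-- scan cannot stop earlier, as an earlier member contained in X would
-- precede a superset of itself.
induced-fixes-members : ∀ {n} (Y : List (Subset n)) → Coherent Y →
  (X : Subset n) → X ∈ Y → induced Y X ≡ X
induced-fixes-members (W ∷ Y) coh X X∈ with W ⊆? X | X∈
... | yes _   | here refl = refl
... | yes W⊆X | there X∈Y =
  ⊥-elim (coh zero (suc (index X∈Y)) (s≤s z≤n) (subst (W ⊆_) (lookup-index X∈Y) W⊆X))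
... | no W⊈W  | here refl = ⊥-elim (W⊈W ⊆-refl)
... | no _    | there X∈Y = induced-fixes-members Y (coherent-tail W Y coh) X X∈Y

substitutable-fixed-subset : ∀ {n} (f : ChoiceFunction n) → IsChoiceFunction f →
  Substitutable f → (X Z : Subset n) → f X ≡ X → Z ⊆ X → f Z ≡ Z
substitutable-fixed-subset f choice subst-f X Z fX≡X Z⊆X = ⊆-antisym (choice Z) Z⊆fZ
  where
  Z⊆fZ : Z ⊆ f Z
  Z⊆fZ x∈Z = subst-f Z X Z⊆X (x∈p∩q⁺ (subst (_ ∈ₛ_) (sym fX≡X) (Z⊆X x∈Z) , x∈Z))

mainTheorem6 : (n : ℕ) (Y : List (Subset n)) →
    IsPreferenceList Y → Coherent Y → Substitutable (induced Y) →
    (X : Subset n) → X ∈ Y → (Z : Subset n) → Z ⊆ X → Z ∈ Y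
mainTheorem6 n Y (ys , refl) coh subst-f X X∈Y Z Z⊆X =
  subst (_∈ Y) fZ≡Z (induced-∈ Y (∈-++⁺ʳ ys (here refl)) Z)
  where
  fZ≡Z : induced Y Z ≡ Z
  fZ≡Z = substitutable-fixed-subset (induced Y) (induced-isChoice Y) subst-f X Z
           (induced-fixes-members Y coh X X∈Y) Z⊆X
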